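{- Let $I$ be a sorted item sequence, and let $I_1$ be the subsequence of $I$ consisting of the items that are sole class-1 items in the assignment $f$ produced by $MM_2$ for $I$. Then for an arbitrary assignment $g$ for $I$ without cardinality constraints, there exists an assignment $g'$ for $I$ without cardinality constraints such that $g$ and $g'$ have the same number of non-empty bins and every item in $I_1$ is a sole item in $g'$.
   Context: An item sequence $I=(a_1,\dots,a_n)\in(0,1]^n$ is sorted if $a_1\ge\cdots\ge a_n$. An assignment without cardinality constraints is a map $f:\{1,\dots,n\}\to\mathbb{N}$ with $\sum_{i:f(i)=j}a_i\le1$ for every bin $j$. An item is a sole item if its bin contains no other item. A class-1 item is an item of size in $(\frac12,1]$. Algorithm $MM_k$ (here $k=2$): sort the input non-increasingly, with head pointer $h=1$, tail pointer $t=n$, and one current open bin. Repeat: if the current bin already contains $k$ items, close it and open a new empty bin; else if the head item $a_h$ fits (current load plus $a_h\le1$), pack it and advance $h$; else if the tail item $a_t$ fits, pack it and decrease $t$; else close the current bin and open a new empty bin. Stop when all items are packed.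
   Formalization: The item sizes $a_i$ are rational rather than real, and $MM_2$ keeps items of equal size in their input order. -}

module Defs where

open import Data.Nat as ℕ using (ℕ; zero; suc; _∸_; _≡ᵇ_)
open import Data.Rational using (ℚ; 0ℚ; 1ℚ; ½; _+_; _≤_; _<_)
open import Data.Rational.Properties using (_≤?_)
open import Data.Fin using (Fin; toℕ)
open import Data.List using (List; []; _∷_; length; lookup; map; foldr; deduplicate; allFin)
open import Data.Bool using (Bool; true; false; if_then_else_)
open import Relation.Nullary using (does)
open import Relation.Binary.PropositionalEquality using (_≡_)
open import Data.Product using (_×_)

Item : List ℚ → Set
Item I = Fin (length I)

size : (I : List ℚ) → Item I → ℚ
size I i = lookup I i

ValidSizes : List ℚ → Set
ValidSizes I = ∀ (i : Item I) → (0ℚ < size I i) × (size I i ≤ 1ℚ)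

Sorted : List ℚ → Set
Sorted I = ∀ (i j : Item I) → toℕ i ℕ.≤ toℕ j → size I j ≤ size I i

load : (I : List ℚ) → (Item I → ℕ) → ℕ → ℚ
load I g j = foldr _+_ 0ℚ (map (λ i → if g i ≡ᵇ j then size I i else 0ℚ) (allFin (length I)))

IsAssignment : (I : List ℚ) → (Item I → ℕ) → Set
IsAssignment I g = ∀ (j : ℕ) → load I g j ≤ 1ℚ

numBins : (I : List ℚ) → (Item I → ℕ) → ℕ
numBins I g = length (deduplicate ℕ._≟_ (map g (allFin (length I))))

Sole : (I : List ℚ) → (Item I → ℕ) → Item I → Set
Sole I g i = ∀ (i' : Item I) → g i' ≡ g i → i' ≡ i

Class1 : (I : List ℚ) → Item I → Set
Class1 I i = ½ < size I i

-- Algorithm MM_k (input assumed already sorted; sorting step is the identity)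

at : List ℚ → ℕ → ℚ
at []       _       = 0ℚ
at (x ∷ _)  zero    = x
at (_ ∷ xs) (suc k) = at xs k

record MMState : Set where
  constructor mkState
  field
    head   : ℕ        -- head pointer (0-based)
    tail   : ℕ        -- tail pointer (0-based)
    left   : ℕ        -- number of items still unpacked
    bin    : ℕ
    count  : ℕ
    lvl    : ℚ        -- current load of the open bin
    assign : ℕ → ℕ    -- bin of each packed item (by 0-based index)

update : (ℕ → ℕ) → ℕ → ℕ → (ℕ → ℕ)
update f p v q = if q ≡ᵇ p then v else f q

mmRun : ℕ → List ℚ → ℕ → MMState → MMState
mmRun zero      I k s = s
mmRun (suc fuel) I k s@(mkState h t zero b c L asg) = s
mmRun (suc fuel) I k (mkState h t (suc r) b c L asg) =
  if c ≡ᵇ k then mmRun fuel I k (mkState h t (suc r) (suc b) 0 0ℚ asg)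
  else if does ((L + at I h) ≤? 1ℚ)
    then mmRun fuel I k (mkState (suc h) t r b (suc c) (L + at I h) (update asg h b))
  else if does ((L + at I t) ≤? 1ℚ)
    then mmRun fuel I k (mkState h (t ∸ 1) r b (suc c) (L + at I t) (update asg t b))
  else mmRun fuel I k (mkState h t (suc r) (suc b) 0 0ℚ asg)

-- the assignment produced by MM_k; fuel 3n+1 suffices since every bin
-- receives at least one item before being closed
MM : ℕ → (I : List ℚ) → Item I → ℕ
MM k I i = MMState.assign
  (mmRun (suc (3 ℕ.* length I)) I k (mkState 0 (length I ∸ 1) (length I) 0 0 0ℚ (λ _ → 0)))
  (toℕ i)

-- Call an item an anchor if it comes no later than some sole class-1 item of MM₂. Anchors are
-- class-1, so an assignment g puts them into pairwise different bins. The key property of MM₂: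
-- an item z fitting beside a sole class-1 item s was packed from the tail into a two-item bin
-- {a, z} with a head item a < s. Indeed, when the bin of s was closed, the tail item did not fit
-- beside s, so (the input being sorted) neither did any item still unpacked at that time.
-- Hence every non-anchor that g puts beside an anchor has an anchor as its MM₂-partner. Moving
-- each such item into the g-bin of its partner yields g′: an anchor's bin then holds the anchor
-- and at most its MM₂-partner, all other bins are unchanged, no bin is emptied, and every sole
-- class-1 item of MM₂ is alone in g′.
module Submission where

open import Defs
open import Data.List using (List)
open import Data.Rational using (ℚ)
open import Data.Nat using (ℕ)
open import Data.Product using (Σ; _×_)
open import Relation.Binary.PropositionalEquality using (_≡_)

open import Data.Bool using (true; false; if_then_else_)
open import Data.Empty using (⊥-elim)
open import Data.Fin using (Fin; zero; suc; toℕ; fromℕ<)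
import Data.Fin.Properties as Fin
open import Data.List using (_∷_; length; map; foldr; tabulate; allFin; deduplicate)
open import Data.List.Properties using (map-tabulate; tabulate-cong)
open import Data.List.Membership.Propositional using (_∈_)
open import Data.List.Membership.Propositional.Properties
  using (∈-map⁺; ∈-map⁻; ∈-allFin; ∈-deduplicate⁺; ∈-deduplicate⁻)
open import Data.List.Membership.Propositional.Properties.WithK using (unique∧set⇒bag)
open import Data.List.Relation.Binary.BagAndSetEquality using (∼bag⇒↭)
open import Data.List.Relation.Binary.Permutation.Propositional.Properties using (↭-length)
open import Data.Nat using (zero; suc; _≡ᵇ_; _∸_; s≤s)
  renaming (_≤_ to _≤ₙ_; _<_ to _<ₙ_; _+_ to _+ₙ_; _*_ to _*ₙ_)
import Data.Nat.Properties as ℕ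
open import Data.List.Relation.Unary.Unique.DecPropositional.Properties ℕ._≟_ using (deduplicate-!)
open import Data.Product using (∃; _,_; proj₁; proj₂)
open import Data.Rational using (0ℚ; 1ℚ; ½; _+_; _≤_; _<_)
import Data.Rational.Properties as ℚ
open import Data.Sum using (_⊎_; inj₁; inj₂; [_,_]′)
import Data.Sum as Sum
open import Function using (id; _∘_)
open import Function.Bundles using (mk⇔)
open import Relation.Nullary using (¬_; Dec; yes; no; does)
open import Relation.Nullary.Decidable using (_×-dec_; _→-dec_; ¬?; decidable-stable)
open import Relation.Binary.PropositionalEquality
  using (_≢_; refl; sym; trans; cong; cong₂; subst; subst₂; module ≡-Reasoning)

if-≡ᵇ-≡ : ∀ {A : Set} {m n} (x y : A) → m ≡ n → (if m ≡ᵇ n then x else y) ≡ x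
if-≡ᵇ-≡ {m = m} {n} x y m≡n with m ≡ᵇ n | ℕ.≡⇒≡ᵇ m n m≡n
... | true  | _  = refl
... | false | ()

if-≡ᵇ-≢ : ∀ {A : Set} {m n} (x y : A) → m ≢ n → (if m ≡ᵇ n then x else y) ≡ y
if-≡ᵇ-≢ {m = m} {n} x y m≢n with m ≡ᵇ n | ℕ.≡ᵇ⇒≡ m n
... | true  | ≡ᵇ⇒≡ = ⊥-elim (m≢n (≡ᵇ⇒≡ _))
... | false | _    = refl

-- `with` cannot abstract a ℚ comparison out of an `mmRun` goal: conversion unfolds `_≤?_`.
if-does : ∀ {A P : Set} (Q : A → Set) (d : Dec P) {x y : A} →
          (P → Q x) → (¬ P → Q y) → Q (if does d then x else y)
if-does Q (yes p) on-yes _ = on-yes p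
if-does Q (no ¬p) _ on-no  = on-no ¬p

update-≡ : ∀ (f : ℕ → ℕ) p v → update f p v p ≡ v
update-≡ f p v = if-≡ᵇ-≡ {m = p} v (f p) refl

update-≢ : ∀ (f : ℕ → ℕ) {p v w} → w ≢ p → update f p v w ≡ f w
update-≢ f {v = v} {w} = if-≡ᵇ-≢ v (f w)

∑ : ∀ {m} → (Fin m → ℚ) → ℚ
∑ f = foldr _+_ 0ℚ (tabulate f)

∑-cong : ∀ {m} {f f′ : Fin m → ℚ} → (∀ i → f i ≡ f′ i) → ∑ f ≡ ∑ f′
∑-cong f≗f′ = cong (foldr _+_ 0ℚ) (tabulate-cong f≗f′)

∑-zero : ∀ {m} (f : Fin m → ℚ) → (∀ i → f i ≡ 0ℚ) → ∑ f ≡ 0ℚ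
∑-zero {zero}  f _   = refl
∑-zero {suc m} f f≗0 = cong₂ _+_ (f≗0 zero) (∑-zero (f ∘ suc) (f≗0 ∘ suc))

∑-single : ∀ {m} (f : Fin m → ℚ) u → (∀ i → i ≢ u → f i ≡ 0ℚ) → ∑ f ≡ f u
∑-single f zero vanish =
  trans (cong (f zero +_) (∑-zero (f ∘ suc) λ i → vanish (suc i) λ ())) (ℚ.+-identityʳ _)
∑-single f (suc u) vanish =
  trans (cong₂ _+_ (vanish zero λ ())
                   (∑-single (f ∘ suc) u λ i i≢u → vanish (suc i) (i≢u ∘ Fin.suc-injective)))
        (ℚ.+-identityˡ _)

∑-pair : ∀ {m} (f : Fin m → ℚ) {u v} → u ≢ v → (∀ i → i ≢ u → i ≢ v → f i ≡ 0ℚ) →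
         ∑ f ≡ f u + f v
∑-pair f {zero}  {zero}  u≢v _ = ⊥-elim (u≢v refl)
∑-pair f {zero}  {suc v} _ vanish =
  cong (f zero +_)
       (∑-single (f ∘ suc) v λ i i≢v → vanish (suc i) (λ ()) (i≢v ∘ Fin.suc-injective))
∑-pair f {suc u} {zero}  u≢v vanish =
  trans (∑-pair f (u≢v ∘ sym) λ i i≢v i≢u → vanish i i≢u i≢v) (ℚ.+-comm (f zero) (f (suc u)))
∑-pair f {suc u} {suc v} u≢v vanish =
  trans (cong₂ _+_ (vanish zero (λ ()) (λ ()))
                   (∑-pair (f ∘ suc) (u≢v ∘ cong suc) λ i i≢u i≢v →
                      vanish (suc i) (i≢u ∘ Fin.suc-injective) (i≢v ∘ Fin.suc-injective)))
        (ℚ.+-identityˡ _)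

∑-nonneg : ∀ {m} (f : Fin m → ℚ) → (∀ i → 0ℚ ≤ f i) → 0ℚ ≤ ∑ f
∑-nonneg {zero}  f _      = ℚ.≤-refl
∑-nonneg {suc m} f nonneg = ℚ.+-mono-≤ (nonneg zero) (∑-nonneg (f ∘ suc) (nonneg ∘ suc))

≤-∑ : ∀ {m} (f : Fin m → ℚ) → (∀ i → 0ℚ ≤ f i) → ∀ u → f u ≤ ∑ f
≤-∑ f nonneg zero =
  subst (_≤ ∑ f) (ℚ.+-identityʳ (f zero))
        (ℚ.+-monoʳ-≤ (f zero) (∑-nonneg (f ∘ suc) (nonneg ∘ suc)))
≤-∑ f nonneg (suc u) =
  subst (_≤ ∑ f) (ℚ.+-identityˡ (f (suc u)))
        (ℚ.+-mono-≤ (nonneg zero) (≤-∑ (f ∘ suc) (nonneg ∘ suc) u))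

pair-≤-∑ : ∀ {m} (f : Fin m → ℚ) → (∀ i → 0ℚ ≤ f i) → ∀ {u v} → u ≢ v →
           f u + f v ≤ ∑ f
pair-≤-∑ f nonneg {zero}  {zero}  u≢v = ⊥-elim (u≢v refl)
pair-≤-∑ f nonneg {zero}  {suc v} _   = ℚ.+-monoʳ-≤ (f zero) (≤-∑ (f ∘ suc) (nonneg ∘ suc) v)
pair-≤-∑ f nonneg {suc u} {zero}  u≢v =
  subst (_≤ ∑ f) (ℚ.+-comm (f zero) (f (suc u))) (pair-≤-∑ f nonneg (u≢v ∘ sym))
pair-≤-∑ f nonneg {suc u} {suc v} u≢v =
  subst (_≤ ∑ f) (ℚ.+-identityˡ _)
        (ℚ.+-mono-≤ (nonneg zero) (pair-≤-∑ (f ∘ suc) (nonneg ∘ suc) (u≢v ∘ cong suc)))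

binSize : (I : List ℚ) → (Item I → ℕ) → ℕ → Item I → ℚ
binSize I h j i = if h i ≡ᵇ j then size I i else 0ℚ

load-∑ : ∀ I (h : Item I → ℕ) j → load I h j ≡ ∑ (binSize I h j)
load-∑ I h j = cong (foldr _+_ 0ℚ) (map-tabulate id (binSize I h j))

module _ (I : List ℚ) (h : Item I → ℕ) {j : ℕ} where

  binSize-∈ : ∀ {i} → h i ≡ j → binSize I h j i ≡ size I i
  binSize-∈ {i} = if-≡ᵇ-≡ (size I i) 0ℚ

  binSize-∉ : ∀ {i} → h i ≢ j → binSize I h j i ≡ 0ℚ
  binSize-∉ {i} = if-≡ᵇ-≢ (size I i) 0ℚ

  load-single : ∀ {u} → h u ≡ j → (∀ w → h w ≡ j → w ≡ u) → load I h j ≡ size I u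
  load-single {u} u∈j only = begin
    load I h j            ≡⟨ load-∑ I h j ⟩
    ∑ (binSize I h j)     ≡⟨ ∑-single _ u (λ i i≢u → binSize-∉ (i≢u ∘ only i)) ⟩
    binSize I h j u       ≡⟨ binSize-∈ u∈j ⟩
    size I u              ∎
    where open ≡-Reasoning

  load-pair : ∀ {u v} → u ≢ v → h u ≡ j → h v ≡ j →
              (∀ w → h w ≡ j → w ≡ u ⊎ w ≡ v) → load I h j ≡ size I u + size I v
  load-pair {u} {v} u≢v u∈j v∈j only = begin
    load I h j                         ≡⟨ load-∑ I h j ⟩
    ∑ (binSize I h j)                  ≡⟨ ∑-pair _ u≢v (λ i i≢u i≢v →
                                                binSize-∉ ([ i≢u , i≢v ]′ ∘ only i)) ⟩
    binSize I h j u + binSize I h j v  ≡⟨ cong₂ _+_ (binSize-∈ u∈j) (binSize-∈ v∈j) ⟩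
    size I u + size I v                ∎
    where open ≡-Reasoning

load-cong : ∀ I (h h′ : Item I → ℕ) {j} →
            (∀ w → h w ≡ j → h′ w ≡ j) → (∀ w → h′ w ≡ j → h w ≡ j) → load I h j ≡ load I h′ j
load-cong I h h′ {j} to from =
  trans (load-∑ I h j) (trans (∑-cong same-size) (sym (load-∑ I h′ j)))
  where
    same-size : ∀ i → binSize I h j i ≡ binSize I h′ j i
    same-size i with h i ℕ.≟ j
    ... | yes i∈j = trans (binSize-∈ I h i∈j) (sym (binSize-∈ I h′ (to i i∈j)))
    ... | no  i∉j = trans (binSize-∉ I h i∉j) (sym (binSize-∉ I h′ (i∉j ∘ from i)))

pair-≤-load : ∀ I (h : Item I → ℕ) → ValidSizes I → ∀ {u v} → h u ≡ h v → u ≢ v →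
              size I u + size I v ≤ load I h (h u)
pair-≤-load I h valid {u} {v} u∼v u≢v =
  subst₂ _≤_ (cong₂ _+_ (binSize-∈ I h refl) (binSize-∈ I h (sym u∼v))) (sym (load-∑ I h (h u)))
    (pair-≤-∑ (binSize I h (h u)) nonneg u≢v)
  where
    nonneg : ∀ i → 0ℚ ≤ binSize I h (h u) i
    nonneg i with h i ≡ᵇ h u
    ... | true  = ℚ.<⇒≤ (proj₁ (valid i))
    ... | false = ℚ.≤-refl

numBins-cong : ∀ I (h h′ : Item I → ℕ) →
  (∀ i → ∃ λ i′ → h i ≡ h′ i′) → (∀ i′ → ∃ λ i → h′ i′ ≡ h i) →
  numBins I h ≡ numBins I h′
numBins-cong I h h′ h⊆h′ h′⊆h =
  ↭-length (∼bag⇒↭ (unique∧set⇒bag (deduplicate-! _) (deduplicate-! _)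
                                    (mk⇔ (image-⊆ h h′ h⊆h′) (image-⊆ h′ h h′⊆h))))
  where
    bins : (Item I → ℕ) → List ℕ
    bins k = deduplicate ℕ._≟_ (map k (allFin (length I)))
    image-⊆ : ∀ k k′ → (∀ i → ∃ λ i′ → k i ≡ k′ i′) → ∀ {x} → x ∈ bins k → x ∈ bins k′
    image-⊆ k k′ k⊆k′ x∈k with ∈-map⁻ k (∈-deduplicate⁻ ℕ._≟_ _ x∈k)
    ... | i , _ , refl with k⊆k′ i
    ...   | i′ , ki≡k′i′ = ∈-deduplicate⁺ ℕ._≟_ (subst (_∈ _) (sym ki≡k′i′) (∈-map⁺ k′ (∈-allFin i′)))

class1-pair-overflows : ∀ {x y} → ½ < x → ½ < y → ¬ (x + y ≤ 1ℚ)
class1-pair-overflows ½<x ½<y x+y≤1 = ℚ.<-irrefl refl (ℚ.<-≤-trans (ℚ.+-mono-< ½<x ½<y) x+y≤1)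

at-toℕ : ∀ I (i : Item I) → at I (toℕ i) ≡ size I i
at-toℕ (_ ∷ _) zero    = refl
at-toℕ (_ ∷ I) (suc i) = at-toℕ I i

record Partners (I : List ℚ) (f : Item I → ℕ) (a z : Item I) : Set where
  field
    same-bin : f a ≡ f z
    distinct : a ≢ z
    fit      : size I a + size I z ≤ 1ℚ
    alone    : ∀ w → f w ≡ f a → w ≡ a ⊎ w ≡ z

EarlierPartners : (I : List ℚ) → (Item I → ℕ) → Set
EarlierPartners I f = ∀ s z → Class1 I s → Sole I f s → z ≢ s → size I s + size I z ≤ 1ℚ →
  Σ (Item I) λ a → toℕ a <ₙ toℕ s × Partners I f a z

module MM₂ (I : List ℚ) (valid : ValidSizes I) (sorted : Sorted I) where

  n : ℕ
  n = length I

  item : ∀ {k} → k <ₙ n → Item I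
  item k<n = fromℕ< k<n

  at-item : ∀ {k} (k<n : k <ₙ n) → at I k ≡ size I (item k<n)
  at-item k<n = trans (cong (at I) (sym (Fin.toℕ-fromℕ< k<n))) (at-toℕ I (item k<n))

  at≤1 : ∀ {k} → k <ₙ n → at I k ≤ 1ℚ
  at≤1 k<n = subst (_≤ 1ℚ) (sym (at-item k<n)) (proj₂ (valid (item k<n)))

  at-antitone : ∀ {i j} → i ≤ₙ j → j <ₙ n → at I j ≤ at I i
  at-antitone i≤j j<n =
    subst₂ _≤_ (sym (at-item j<n)) (sym (at-item i<n))
      (sorted (item i<n) (item j<n)
        (subst₂ _≤ₙ_ (sym (Fin.toℕ-fromℕ< i<n)) (sym (Fin.toℕ-fromℕ< j<n)) i≤j))
    where i<n = ℕ.≤-<-trans i≤j j<n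

  class1-before : ∀ {s z} → s <ₙ n → ½ < at I s → at I s + at I z ≤ 1ℚ → s <ₙ z
  class1-before {s} {z} s<n class1 fit with s ℕ.<? z
  ... | yes s<z = s<z
  ... | no  s≮z =
    ⊥-elim (class1-pair-overflows class1 (ℚ.<-≤-trans class1 (at-antitone (ℕ.≮⇒≥ s≮z) s<n)) fit)

  Packed : (h r w : ℕ) → Set
  Packed h r w = w <ₙ n × (w <ₙ h ⊎ h +ₙ r ≤ₙ w)

  Unpacked : (h r z : ℕ) → Set
  Unpacked h r z = h ≤ₙ z × z <ₙ h +ₙ r

  SoleIn : (h r : ℕ) → (ℕ → ℕ) → ℕ → Set
  SoleIn h r asg s = ∀ w → Packed h r w → asg w ≡ asg s → w ≡ s

  -- β is the current head in tail-mates and the sole item s in SoleMatesOf.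
  record Mate (h r b c : ℕ) (asg : ℕ → ℕ) (β z : ℕ) : Set where
    field
      mate        : ℕ
      mate<β      : mate <ₙ β
      mate-packed : Packed h r mate
      packed      : Packed h r z
      same-bin    : asg mate ≡ asg z
      distinct    : mate ≢ z
      fit         : at I mate + at I z ≤ 1ℚ
      closed      : asg mate <ₙ b ⊎ (asg mate ≡ b × c ≡ 2)
      alone       : ∀ w → Packed h r w → asg w ≡ asg mate → w ≡ mate ⊎ w ≡ z

  Pending : (h r b c : ℕ) → (ℕ → ℕ) → (s z : ℕ) → Set
  Pending h r b c asg s z = asg s ≡ b × c ≡ 1 × Unpacked h r z

  SoleMatesOf : (h r b c : ℕ) → (ℕ → ℕ) → ℕ → Set
  SoleMatesOf h r b c asg s = ½ < at I s → SoleIn h r asg s →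
    ∀ z → z <ₙ n → z ≢ s → at I s + at I z ≤ 1ℚ →
    Pending h r b c asg s z ⊎ Mate h r b c asg s z

  SoleMates : (h r b c : ℕ) → (ℕ → ℕ) → Set
  SoleMates h r b c asg = ∀ s → Packed h r s → SoleMatesOf h r b c asg s

  data CurrentBin (r b : ℕ) (asg : ℕ → ℕ) : (h c : ℕ) → ℚ → Set where
    empty  : ∀ {h} → (∀ w → Packed h r w → asg w ≢ b) → CurrentBin r b asg h 0 0ℚ
    single : ∀ {h L} → L ≡ at I h → asg h ≡ b →
             (∀ w → Packed (suc h) r w → asg w ≡ b → w ≡ h) → CurrentBin r b asg (suc h) 1 L
    full   : ∀ {h L} → CurrentBin r b asg h 2 L

  record Invariant (h t r b c : ℕ) (L : ℚ) (asg : ℕ → ℕ) : Set where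
    field
      in-range   : h +ₙ r ≤ₙ n
      tail-ptr   : ∀ {r′} → r ≡ suc r′ → t ≡ h +ₙ r′
      current    : CurrentBin r b asg h c L
      bins≤      : ∀ w → Packed h r w → asg w ≤ₙ b
      tail-mates : ∀ z → z <ₙ n → h +ₙ r ≤ₙ z → Mate h r b c asg h z
      sole-mates : SoleMates h r b c asg

  initial : Invariant 0 (n ∸ 1) n 0 0 0ℚ (λ _ → 0)
  initial = record
    { in-range   = ℕ.≤-refl
    ; tail-ptr   = cong (_∸ 1)
    ; current    = empty λ w pw → ⊥-elim (nothing-packed pw)
    ; bins≤      = λ w pw → ⊥-elim (nothing-packed pw)
    ; tail-mates = λ z z<n n≤z → ⊥-elim (ℕ.<⇒≱ z<n n≤z)
    ; sole-mates = λ s ps → ⊥-elim (nothing-packed ps)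
    }
    where
      nothing-packed : ∀ {w} → ¬ Packed 0 n w
      nothing-packed (w<n , inj₂ n≤w) = ℕ.<⇒≱ w<n n≤w

  mate-close : ∀ {h r b c c₂ asg β z} → Mate h r b c asg β z → Mate h r (suc b) c₂ asg β z
  mate-close m = record
    { Mate m hiding (closed)
    ; closed = inj₁ ([ ℕ.m<n⇒m<1+n , (λ (mate∈b , _) → s≤s (ℕ.≤-reflexive mate∈b)) ]′
                       (Mate.closed m))
    }

  close : ∀ {h t r b c L asg} → Invariant h t r b c L asg →
    (∀ {s z} → Packed h r s → Pending h r b c asg s z → 1ℚ < at I s + at I z) →
    Invariant h t r (suc b) 0 0ℚ asg
  close inv blocked = record
    { in-range   = in-range
    ; tail-ptr   = tail-ptr
    ; current    = empty λ w pw w∈b → ℕ.1+n≰n (subst (_≤ₙ _) w∈b (bins≤ w pw))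
    ; bins≤      = λ w pw → ℕ.m≤n⇒m≤1+n (bins≤ w pw)
    ; tail-mates = λ z z<n tail → mate-close (tail-mates z z<n tail)
    ; sole-mates = λ s ps class1 sole z z<n z≢s fit →
        [ (λ pending → ⊥-elim (ℚ.<-irrefl refl (ℚ.<-≤-trans (blocked ps pending) fit)))
        , inj₂ ∘ mate-close
        ]′ (sole-mates s ps class1 sole z z<n z≢s fit)
    }
    where open Invariant inv

  record Extends (h r h₂ r₂ p : ℕ) : Set where
    field
      old   : ∀ {w} → Packed h r w → Packed h₂ r₂ w
      new   : ∀ {w} → Packed h₂ r₂ w → Packed h r w ⊎ w ≡ p
      fresh : ∀ {w} → Packed h r w → w ≢ p
      added : Packed h₂ r₂ p

  head-extends : ∀ {h r} → h +ₙ suc r ≤ₙ n → Extends h (suc r) (suc h) r h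
  head-extends {h} {r} in-range = record
    { old   = old
    ; new   = new
    ; fresh = fresh
    ; added = ℕ.<-≤-trans (s≤s (ℕ.m≤m+n h r)) (subst (_≤ₙ n) (ℕ.+-suc h r) in-range)
            , inj₁ (ℕ.n<1+n h)
    }
    where
      old : ∀ {w} → Packed h (suc r) w → Packed (suc h) r w
      old (w<n , inj₁ w<h)  = w<n , inj₁ (ℕ.m<n⇒m<1+n w<h)
      old {w} (w<n , inj₂ tail) = w<n , inj₂ (subst (_≤ₙ w) (ℕ.+-suc h r) tail)
      new : ∀ {w} → Packed (suc h) r w → Packed h (suc r) w ⊎ w ≡ h
      new (w<n , inj₁ w≤h)  = Sum.map₁ (λ w<h → w<n , inj₁ w<h) (ℕ.m<1+n⇒m<n∨m≡n w≤h)
      new {w} (w<n , inj₂ tail) = inj₁ (w<n , inj₂ (subst (_≤ₙ w) (sym (ℕ.+-suc h r)) tail))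
      fresh : ∀ {w} → Packed h (suc r) w → w ≢ h
      fresh (_ , inj₁ w<h)  refl = ℕ.<-irrefl refl w<h
      fresh (_ , inj₂ tail) refl = ℕ.<⇒≱ (s≤s (ℕ.m≤m+n h r)) (subst (_≤ₙ h) (ℕ.+-suc h r) tail)

  head<n : ∀ {h r} → h +ₙ suc r ≤ₙ n → h <ₙ n
  head<n in-range = proj₁ (Extends.added (head-extends in-range))

  last<n : ∀ {h r} → h +ₙ suc r ≤ₙ n → h +ₙ r <ₙ n
  last<n {h} {r} = subst (_≤ₙ n) (ℕ.+-suc h r)

  tail-extends : ∀ {h r} → h +ₙ suc r ≤ₙ n → Extends h (suc r) h r (h +ₙ r)
  tail-extends {h} {r} in-range = record
    { old   = old
    ; new   = new
    ; fresh = fresh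
    ; added = last<n in-range , inj₂ ℕ.≤-refl
    }
    where
      old : ∀ {w} → Packed h (suc r) w → Packed h r w
      old (w<n , inj₁ w<h)  = w<n , inj₁ w<h
      old (w<n , inj₂ tail) = w<n , inj₂ (ℕ.≤-trans (ℕ.+-monoʳ-≤ h (ℕ.n≤1+n r)) tail)
      new : ∀ {w} → Packed h r w → Packed h (suc r) w ⊎ w ≡ h +ₙ r
      new (w<n , inj₁ w<h)  = inj₁ (w<n , inj₁ w<h)
      new {w} (w<n , inj₂ tail) =
        Sum.map (λ last<w → w<n , inj₂ (subst (_≤ₙ w) (sym (ℕ.+-suc h r)) last<w)) sym
                (ℕ.m≤n⇒m<n∨m≡n tail)
      fresh : ∀ {w} → Packed h (suc r) w → w ≢ h +ₙ r
      fresh (_ , inj₁ w<h)  refl = ℕ.<⇒≱ w<h (ℕ.m≤m+n h r)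
      fresh (_ , inj₂ tail) refl = ℕ.1+n≰n (subst (_≤ₙ h +ₙ r) (ℕ.+-suc h r) tail)

  previous-packed : ∀ {h r} → suc h +ₙ r ≤ₙ n → Packed (suc h) r h
  previous-packed {h} {r} in-range = ℕ.<-≤-trans (s≤s (ℕ.m≤m+n h r)) in-range , inj₁ (ℕ.n<1+n h)

  module Pack {h r h₂ r₂ p b c : ℕ} {asg : ℕ → ℕ}
              (e : Extends h r h₂ r₂ p) (c≢2 : c ≢ 2) where
    open Extends e public

    asg′ : ℕ → ℕ
    asg′ = update asg p b

    asg′-p : asg′ p ≡ b
    asg′-p = update-≡ asg p b

    asg′-old : ∀ {w} → Packed h r w → asg′ w ≡ asg w
    asg′-old pw = update-≢ asg (fresh pw)

    same-bin⁻ : ∀ {u v} → Packed h r u → Packed h r v → asg′ u ≡ asg′ v → asg u ≡ asg v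
    same-bin⁻ pu pv u∼v = trans (sym (asg′-old pu)) (trans u∼v (asg′-old pv))

    same-bin⁺ : ∀ {u v} → Packed h r u → Packed h r v → asg u ≡ asg v → asg′ u ≡ asg′ v
    same-bin⁺ pu pv u∼v = trans (asg′-old pu) (trans u∼v (sym (asg′-old pv)))

    bins≤-step : (∀ w → Packed h r w → asg w ≤ₙ b) → ∀ w → Packed h₂ r₂ w → asg′ w ≤ₙ b
    bins≤-step bins≤ w pw with new pw
    ... | inj₁ pw-old = subst (_≤ₙ b) (sym (asg′-old pw-old)) (bins≤ w pw-old)
    ... | inj₂ refl   = ℕ.≤-reflexive asg′-p

    mate-step : ∀ {β β₂ z} → β ≤ₙ β₂ → Mate h r b c asg β z →
                Mate h₂ r₂ b (suc c) asg′ β₂ z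
    mate-step {z = z} β≤β₂ m = record
      { mate        = mate
      ; mate<β      = ℕ.<-≤-trans mate<β β≤β₂
      ; mate-packed = old mate-packed
      ; packed      = old packed
      ; same-bin    = same-bin⁺ mate-packed packed same-bin
      ; distinct    = distinct
      ; fit         = fit
      ; closed      = inj₁ (subst (_<ₙ b) (sym (asg′-old mate-packed)) mate-bin<b)
      ; alone       = alone′
      }
      where
        open Mate m
        mate-bin<b : asg mate <ₙ b
        mate-bin<b = [ id , (λ (_ , c≡2) → ⊥-elim (c≢2 c≡2)) ]′ closed
        alone′ : ∀ w → Packed h₂ r₂ w → asg′ w ≡ asg′ mate → w ≡ mate ⊎ w ≡ z
        alone′ w pw w∼mate with new pw
        ... | inj₁ pw-old = alone w pw-old (same-bin⁻ pw-old mate-packed w∼mate)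
        ... | inj₂ refl   = ⊥-elim (ℕ.<-irrefl (sym b≡mate-bin) mate-bin<b)
          where
            b≡mate-bin : b ≡ asg mate
            b≡mate-bin = trans (sym asg′-p) (trans w∼mate (asg′-old mate-packed))

    old-sole-mate : SoleMates h r b c asg → ∀ {s} → Packed h r s →
                    SoleMatesOf h₂ r₂ b (suc c) asg′ s
    old-sole-mate sole-mates {s} ps class1 sole z z<n z≢s fit
      with sole-mates s ps class1 sole-before z z<n z≢s fit
      where
        sole-before : SoleIn h r asg s
        sole-before w pw w∼s = sole w (old pw) (same-bin⁺ pw ps w∼s)
    ... | inj₂ m            = inj₂ (mate-step ℕ.≤-refl m)
    ... | inj₁ (s∈b , _ , _) =
      ⊥-elim (fresh ps (sym (sole p added (trans asg′-p (trans (sym s∈b) (sym (asg′-old ps)))))))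

    sole-mates-step : SoleMates h r b c asg → SoleMatesOf h₂ r₂ b (suc c) asg′ p →
                      SoleMates h₂ r₂ b (suc c) asg′
    sole-mates-step sole-mates new-sole-mates s ps with new ps
    ... | inj₁ ps-old = old-sole-mate sole-mates ps-old
    ... | inj₂ refl   = new-sole-mates

    joins-occupied-bin : ∀ {q} → Packed h r q → asg q ≡ b → SoleMatesOf h₂ r₂ b (suc c) asg′ p
    joins-occupied-bin pq q∈b _ sole =
      ⊥-elim (fresh pq (sole _ (old pq) (trans (asg′-old pq) (trans q∈b (sym asg′-p)))))

  module HeadStep {h t r b c L asg} (inv : Invariant h t (suc r) b c L asg) (c≢2 : c ≢ 2) where
    open Invariant inv
    open Pack {b = b} {asg = asg} (head-extends in-range) c≢2 public

    tail-mate : ∀ z → z <ₙ n → suc h +ₙ r ≤ₙ z → Mate h (suc r) b c asg h z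
    tail-mate z z<n tail = tail-mates z z<n (subst (_≤ₙ z) (sym (ℕ.+-suc h r)) tail)

    invariant : CurrentBin r b asg′ (suc h) (suc c) (L + at I h) →
                SoleMatesOf (suc h) r b (suc c) asg′ h →
                Invariant (suc h) t r b (suc c) (L + at I h) asg′
    invariant current′ new-sole-mates = record
      { in-range   = subst (_≤ₙ n) (ℕ.+-suc h r) in-range
      ; tail-ptr   = λ r≡ → trans (tail-ptr (cong suc r≡)) (ℕ.+-suc h _)
      ; current    = current′
      ; bins≤      = bins≤-step bins≤
      ; tail-mates = λ z z<n tail → mate-step (ℕ.n≤1+n h) (tail-mate z z<n tail)
      ; sole-mates = sole-mates-step sole-mates new-sole-mates
      }

  pack-head-empty : ∀ {h t r b asg} → Invariant h t (suc r) b 0 0ℚ asg →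
    (∀ w → Packed h (suc r) w → asg w ≢ b) →
    Invariant (suc h) t r b 1 (0ℚ + at I h) (update asg h b)
  pack-head-empty {h} {r = r} {b} inv none =
    invariant (single (ℚ.+-identityˡ (at I h)) asg′-p only) new-sole-mates
    where
      open HeadStep inv (λ ())
      only : ∀ w → Packed (suc h) r w → asg′ w ≡ b → w ≡ h
      only w pw w∈b =
        [ (λ pw-old → ⊥-elim (none w pw-old (trans (sym (asg′-old pw-old)) w∈b))) , id ]′ (new pw)
      new-sole-mates : SoleMatesOf (suc h) r b 1 asg′ h
      new-sole-mates class1 _ z z<n _ fit with z ℕ.<? suc h +ₙ r
      ... | yes z<end =
        inj₁ (asg′-p , refl , class1-before (head<n (Invariant.in-range inv)) class1 fit , z<end)
      ... | no  z≮end = inj₂ (mate-step ℕ.≤-refl (tail-mate z z<n (ℕ.≮⇒≥ z≮end)))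

  pack-head-single : ∀ {h t r b L asg} → Invariant (suc h) t (suc r) b 1 L asg → asg h ≡ b →
    Invariant (suc (suc h)) t r b 2 (L + at I (suc h)) (update asg (suc h) b)
  pack-head-single inv h∈b =
    invariant full (joins-occupied-bin (previous-packed (Invariant.in-range inv)) h∈b)
    where open HeadStep inv (λ ())

  pack-tail : ∀ {h r b L asg} → Invariant (suc h) (suc h +ₙ r) (suc r) b 1 L asg →
    L ≡ at I h → asg h ≡ b → (∀ w → Packed (suc h) (suc r) w → asg w ≡ b → w ≡ h) →
    L + at I (suc h +ₙ r) ≤ 1ℚ →
    Invariant (suc h) (suc h +ₙ r ∸ 1) r b 2 (L + at I (suc h +ₙ r)) (update asg (suc h +ₙ r) b)
  pack-tail {h} {r} {b} {L} {asg} inv L≡ h∈b only fit = record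
    { in-range   = ℕ.≤-trans (ℕ.+-monoʳ-≤ (suc h) (ℕ.n≤1+n r)) in-range
    ; tail-ptr   = λ r≡ → trans (cong (λ x → suc h +ₙ x ∸ 1) r≡) (ℕ.+-suc h _)
    ; current    = full
    ; bins≤      = bins≤-step bins≤
    ; tail-mates = tail-mates′
    ; sole-mates = sole-mates-step sole-mates (joins-occupied-bin h-packed h∈b)
    }
    where
      open Invariant inv
      open Pack {b = b} {c = 1} {asg = asg} (tail-extends {suc h} {r} in-range) (λ ())
      h-packed : Packed (suc h) (suc r) h
      h-packed = previous-packed in-range
      new-mate : Mate (suc h) r b 2 asg′ (suc h) (suc h +ₙ r)
      new-mate = record
        { mate        = h
        ; mate<β      = ℕ.n<1+n h
        ; mate-packed = old h-packed
        ; packed      = added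
        ; same-bin    = trans (asg′-old h-packed) (trans h∈b (sym asg′-p))
        ; distinct    = ℕ.<⇒≢ (s≤s (ℕ.m≤m+n h r))
        ; fit         = subst (λ x → x + at I (suc h +ₙ r) ≤ 1ℚ) L≡ fit
        ; closed      = inj₂ (trans (asg′-old h-packed) h∈b , refl)
        ; alone       = λ w pw w∼h →
            Sum.map₁ (λ pw-old → only w pw-old (trans (same-bin⁻ pw-old h-packed w∼h) h∈b)) (new pw)
        }
      tail-mates′ : ∀ z → z <ₙ n → suc h +ₙ r ≤ₙ z → Mate (suc h) r b 2 asg′ (suc h) z
      tail-mates′ z z<n tail with ℕ.m≤n⇒m<n∨m≡n tail
      ... | inj₁ last<z =
        mate-step ℕ.≤-refl (tail-mates z z<n (subst (_≤ₙ z) (sym (ℕ.+-suc (suc h) r)) last<z))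
      ... | inj₂ refl   = new-mate

  tail-blocked : ∀ {h r b L asg} → Invariant (suc h) (suc h +ₙ r) (suc r) b 1 L asg →
    L ≡ at I h → (∀ w → Packed (suc h) (suc r) w → asg w ≡ b → w ≡ h) →
    1ℚ < L + at I (suc h +ₙ r) →
    ∀ {s z} → Packed (suc h) (suc r) s → Pending (suc h) (suc r) b 1 asg s z → 1ℚ < at I s + at I z
  tail-blocked {h} {r} inv L≡ only overflow {z = z} ps (s∈b , _ , _ , z<end) with only _ ps s∈b
  ... | refl = ℚ.<-≤-trans overflow (ℚ.+-mono-≤ (ℚ.≤-reflexive L≡) (at-antitone z≤last last<n′))
    where
      z≤last = ℕ.≤-pred (subst (z <ₙ_) (ℕ.+-suc (suc h) r) z<end)
      last<n′ = last<n {suc h} {r} (Invariant.in-range inv)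

  all-packed : ∀ {h w} → w <ₙ n → Packed h 0 w
  all-packed {h} {w} w<n =
    w<n , Sum.map₂ (subst (_≤ₙ w) (sym (ℕ.+-identityʳ h))) (ℕ.<-≤-connex w h)

  partners-of-mate : ∀ {h b c asg} {s z : Item I} → Mate h 0 b c asg (toℕ s) (toℕ z) →
    Σ (Item I) λ a → toℕ a <ₙ toℕ s × Partners I (asg ∘ toℕ) a z
  partners-of-mate {asg = asg} {s} {z} m = a , subst (_<ₙ toℕ s) (sym a≡mate) mate<β , record
    { same-bin = trans (cong asg a≡mate) same-bin
    ; distinct = λ a≡z → distinct (trans (sym a≡mate) (cong toℕ a≡z))
    ; fit      = subst₂ (λ x y → x + y ≤ 1ℚ)
                   (trans (cong (at I) (sym a≡mate)) (at-toℕ I a)) (at-toℕ I z) fit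
    ; alone    = λ w w∼a →
        Sum.map (λ w≡mate → Fin.toℕ-injective (trans w≡mate (sym a≡mate))) Fin.toℕ-injective
          (alone (toℕ w) (all-packed (Fin.toℕ<n w)) (trans w∼a (cong asg a≡mate)))
    }
    where
      open Mate m
      a : Item I
      a = item (proj₁ mate-packed)
      a≡mate : toℕ a ≡ mate
      a≡mate = Fin.toℕ-fromℕ< (proj₁ mate-packed)

  earlier-partners : ∀ {h t b c L asg} → Invariant h t 0 b c L asg → EarlierPartners I (asg ∘ toℕ)
  earlier-partners {h} {asg = asg} inv s z class1 sole z≢s fit
    with Invariant.sole-mates inv (toℕ s) (all-packed (Fin.toℕ<n s))
           (subst (½ <_) (sym (at-toℕ I s)) class1) sole′ (toℕ z) (Fin.toℕ<n z) (z≢s ∘ Fin.toℕ-injective)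
           (subst₂ (λ x y → x + y ≤ 1ℚ) (sym (at-toℕ I s)) (sym (at-toℕ I z)) fit)
    where
      sole′ : SoleIn h 0 asg (toℕ s)
      sole′ w (w<n , _) w∼s =
        trans (sym (Fin.toℕ-fromℕ< w<n))
              (cong toℕ (sole (item w<n) (trans (cong asg (Fin.toℕ-fromℕ< w<n)) w∼s)))
  ... | inj₁ (_ , _ , h≤z , z<h+0) =
    ⊥-elim (ℕ.<⇒≱ z<h+0 (subst (_≤ₙ toℕ z) (sym (ℕ.+-identityʳ h)) h≤z))
  ... | inj₂ m                     = partners-of-mate m

  Result : MMState → Set
  Result st = EarlierPartners I (MMState.assign st ∘ toℕ)

  -- Every step lowers c + r * 3, which is written so that it computes once c is a numeral.
  run : ∀ fuel {h t r b c L asg} → Invariant h t r b c L asg → c +ₙ r *ₙ 3 <ₙ fuel →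
        Result (mmRun fuel I 2 (mkState h t r b c L asg))
  run zero _ ()
  run (suc fuel) {r = zero} inv _ = earlier-partners inv
  run (suc fuel) {h} {r = suc r} {L = L} inv (s≤s bound) with Invariant.current inv
  ... | full       = run fuel (close inv λ { _ (_ , () , _) }) (ℕ.<⇒≤ bound)
  ... | empty none = if-does Result (0ℚ + at I h ℚ.≤? 1ℚ)
    (λ _ → run fuel (pack-head-empty inv none) (ℕ.<⇒≤ bound))
    (λ does-not-fit → ⊥-elim (does-not-fit
      (subst (_≤ 1ℚ) (sym (ℚ.+-identityˡ (at I h))) (at≤1 (head<n (Invariant.in-range inv))))))
  ... | single {h′} L≡ h′∈b only with Invariant.tail-ptr inv refl
  ...   | refl = if-does Result (L + at I (suc h′) ℚ.≤? 1ℚ)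
    (λ _ → run fuel (pack-head-single inv h′∈b) (ℕ.<⇒≤ bound))
    (λ _ → if-does Result (L + at I (suc h′ +ₙ r) ℚ.≤? 1ℚ)
      (λ fit → run fuel (pack-tail inv L≡ h′∈b only fit) (ℕ.<⇒≤ bound))
      (λ overflow → run fuel (close inv (tail-blocked inv L≡ only (ℚ.≰⇒> overflow))) bound))

mm₂-earlier-partners : ∀ I → ValidSizes I → Sorted I → EarlierPartners I (MM 2 I)
mm₂-earlier-partners I valid sorted =
  run (suc (3 *ₙ length I)) initial (s≤s (ℕ.≤-reflexive (ℕ.*-comm (length I) 3)))
  where open MM₂ I valid sorted

module Rearrangement (I : List ℚ) (valid : ValidSizes I) (sorted : Sorted I)
  (g : Item I → ℕ) (g-fits : IsAssignment I g) where

  f : Item I → ℕ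
  f = MM 2 I

  Anchor : Item I → Set
  Anchor i = ∃ λ s → Class1 I s × Sole I f s × toℕ i ≤ₙ toℕ s

  Displaced : Item I → Set
  Displaced i = ¬ Anchor i × ∃ λ a → Anchor a × g a ≡ g i

  anchor? : ∀ i → Dec (Anchor i)
  anchor? i = Fin.any? λ s →
    (½ ℚ.<? size I s) ×-dec Fin.all? (λ w → (f w ℕ.≟ f s) →-dec (w Fin.≟ s))
                      ×-dec (toℕ i ℕ.≤? toℕ s)

  displaced? : ∀ i → Dec (Displaced i)
  displaced? i = ¬? (anchor? i) ×-dec Fin.any? (λ a → anchor? a ×-dec (g a ℕ.≟ g i))

  partner? : ∀ i → Dec (∃ λ w → w ≢ i × f w ≡ f i)
  partner? i = Fin.any? λ w → ¬? (w Fin.≟ i) ×-dec (f w ℕ.≟ f i)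

  sharing-fits : ∀ {u v} → g u ≡ g v → u ≢ v → size I u + size I v ≤ 1ℚ
  sharing-fits u∼v u≢v = ℚ.≤-trans (pair-≤-load I g valid u∼v u≢v) (g-fits _)

  anchor-class1 : ∀ {a} → Anchor a → Class1 I a
  anchor-class1 {a} (s , class1 , _ , a≤s) = ℚ.<-≤-trans class1 (sorted a s a≤s)

  anchors-apart : ∀ {a a′} → Anchor a → Anchor a′ → g a ≡ g a′ → a ≡ a′
  anchors-apart {a} {a′} anc anc′ a∼a′ = decidable-stable (a Fin.≟ a′) λ a≢a′ →
    class1-pair-overflows (anchor-class1 anc) (anchor-class1 anc′) (sharing-fits a∼a′ a≢a′)

  displaced-partner : ∀ {z} → Displaced z → ∃ λ a → Anchor a × Partners I f a z
  displaced-partner {z} (not-anchor , a , anc@(s , class1 , sole , a≤s) , a∼z)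
    with mm₂-earlier-partners I valid sorted s z class1 sole z≢s fit
    where
      z≢s : z ≢ s
      z≢s refl = not-anchor (s , class1 , sole , ℕ.≤-refl)
      fit : size I s + size I z ≤ 1ℚ
      fit = ℚ.≤-trans (ℚ.+-monoˡ-≤ (size I z) (sorted a s a≤s))
                      (sharing-fits a∼z λ a≡z → not-anchor (subst Anchor a≡z anc))
  ... | a′ , a′<s , partners = a′ , (s , class1 , sole , ℕ.<⇒≤ a′<s) , partners

  -- Opaque, so that case splits on displaced? do not unfold g′ in hypotheses about it.
  opaque
    g′ : Item I → ℕ
    g′ i with displaced? i | partner? i
    ... | yes _ | yes (w , _) = g w
    ... | _     | _           = g i

    g′-stays : ∀ {i} → ¬ Displaced i → g′ i ≡ g i
    g′-stays {i} not-displaced with displaced? i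
    ... | yes displaced = ⊥-elim (not-displaced displaced)
    ... | no _          = refl

    g′-moves : ∀ {i} → Displaced i → ∃ λ a → Anchor a × Partners I f a i × g′ i ≡ g a
    g′-moves {i} displaced with displaced-partner displaced
    ... | a , anc , partners with displaced? i | partner? i
    ...   | no not-displaced | _                = ⊥-elim (not-displaced displaced)
    ...   | yes _ | no no-partner               = ⊥-elim (no-partner (a , distinct , same-bin))
      where open Partners partners
    ...   | yes _ | yes (w , w≢i , w∼i)         =
      a , anc , partners , cong g ([ id , ⊥-elim ∘ w≢i ]′ (alone w (trans w∼i (sym same-bin))))
      where open Partners partners

  anchor-stays : ∀ {a} → Anchor a → g′ a ≡ g a
  anchor-stays anc = g′-stays λ (not-anchor , _) → not-anchor anc

  g′-anchor-bin : ∀ {a w} → Anchor a → g′ w ≡ g a → w ≡ a ⊎ Partners I f a w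
  g′-anchor-bin {a} {w} anc w∼a with displaced? w
  ... | yes displaced =
    let a′ , anc′ , partners , moved = g′-moves displaced
    in inj₂ (subst (λ x → Partners I f x w) (anchors-apart anc′ anc (trans (sym moved) w∼a)) partners)
  ... | no not-displaced with anchor? w
  ...   | yes anc-w     = inj₁ (anchors-apart anc-w anc (trans (sym (g′-stays not-displaced)) w∼a))
  ...   | no not-anchor =
    ⊥-elim (not-displaced (not-anchor , a , anc , sym (trans (sym (g′-stays not-displaced)) w∼a)))

  anchor-bin-fits : ∀ {a} → Anchor a → load I g′ (g a) ≤ 1ℚ
  anchor-bin-fits {a} anc with Fin.any? (λ w → ¬? (w Fin.≟ a) ×-dec (g′ w ℕ.≟ g a))
  ... | yes (w , w≢a , w∼a) with g′-anchor-bin anc w∼a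
  ...   | inj₁ w≡a      = ⊥-elim (w≢a w≡a)
  ...   | inj₂ partners =
    subst (_≤ 1ℚ) (sym (load-pair I g′ (w≢a ∘ sym) (anchor-stays anc) w∼a only-a-w))
          (Partners.fit partners)
    where
      only-a-w : ∀ u → g′ u ≡ g a → u ≡ a ⊎ u ≡ w
      only-a-w u u∼a =
        [ inj₁ , (λ partners-u → Partners.alone partners u (sym (Partners.same-bin partners-u))) ]′
          (g′-anchor-bin anc u∼a)
  anchor-bin-fits {a} anc | no no-other =
    subst (_≤ 1ℚ) (sym (load-single I g′ (anchor-stays anc) only-a)) (proj₂ (valid a))
    where
      only-a : ∀ u → g′ u ≡ g a → u ≡ a
      only-a u u∼a = decidable-stable (u Fin.≟ a) λ u≢a → no-other (u , u≢a , u∼a)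

  g′-fits : IsAssignment I g′
  g′-fits j with Fin.any? (λ a → anchor? a ×-dec (g a ℕ.≟ j))
  ... | yes (a , anc , refl) = anchor-bin-fits anc
  ... | no no-anchor         = subst (_≤ 1ℚ) (load-cong I g g′ stays returns) (g-fits j)
    where
      stays : ∀ w → g w ≡ j → g′ w ≡ j
      stays w w∈j =
        trans (g′-stays λ (_ , a , anc , a∼w) → no-anchor (a , anc , trans a∼w w∈j)) w∈j
      returns : ∀ w → g′ w ≡ j → g w ≡ j
      returns w w∈j with displaced? w
      ... | yes displaced =
        let a , anc , _ , moved = g′-moves displaced
        in ⊥-elim (no-anchor (a , anc , trans (sym moved) w∈j))
      ... | no not-displaced = trans (sym (g′-stays not-displaced)) w∈j

  g′-numBins : numBins I g ≡ numBins I g′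
  g′-numBins = numBins-cong I g g′ g⊆g′ g′⊆g
    where
      g⊆g′ : ∀ i → ∃ λ i′ → g i ≡ g′ i′
      g⊆g′ i with displaced? i
      ... | yes (_ , a , anc , a∼i) = a , trans (sym a∼i) (sym (anchor-stays anc))
      ... | no not-displaced        = i , sym (g′-stays not-displaced)
      g′⊆g : ∀ i → ∃ λ i′ → g′ i ≡ g i′
      g′⊆g i with displaced? i
      ... | yes displaced    = let a , _ , _ , moved = g′-moves displaced in a , moved
      ... | no not-displaced = i , g′-stays not-displaced

  g′-keeps-sole : ∀ i → Class1 I i → Sole I f i → Sole I g′ i
  g′-keeps-sole i class1 sole w w∼i with g′-anchor-bin anc (trans w∼i (anchor-stays anc))
    where
      anc : Anchor i
      anc = i , class1 , sole , ℕ.≤-refl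
  ... | inj₁ w≡i     = w≡i
  ... | inj₂ partners = sole w (sym (Partners.same-bin partners))

lemma2 : (I : List ℚ) → ValidSizes I → Sorted I →
    (g : Item I → ℕ) → IsAssignment I g →
    Σ (Item I → ℕ) (λ g' → IsAssignment I g' × (numBins I g ≡ numBins I g') ×
      (∀ (i : Item I) → Class1 I i → Sole I (MM 2 I) i → Sole I g' i))
lemma2 I valid sorted g g-fits = g′ , g′-fits , g′-numBins , g′-keeps-sole
  where open Rearrangement I valid sorted g g-fits
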